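{- Let $G$ be a finite bipartite graph on $\Sigma_1=\{0,\dots,N-1\}$ with nonempty bipartition classes $V_1,V_2$, $n_1=|V_1|$, and assume (A1): every $x\in V_1$ has degree $d_1$ in $G$, and $d_2:=\max_{y\in V_2}\deg(y)\le d_1-1$, where $d_1\ge2$. For $\ell\ge0$ put $t_\ell=\frac{d_1^{\ell+1}-1}{d_1-1}+1$ and let $\tilde\gamma=\frac{\log(N/n_1)}{\log d_1}$. Let $\underline X$ be a uniformly chosen vertex of $G_n$. Then for every $n\ge1$ and every integer $\ell$ with $0\le\ell\le n-1$ and $t_\ell\ge\max\{\deg_n(\underline y):\underline y\in\Sigma_n,\ y_n\in V_2\}$, $$\mathbb P\big(\deg_n(\underline X)>t_\ell\big)=\Big(\frac{n_1}{N}\Big)^{\ell+1};$$ in particular the degree distribution of $G_n$ has power law decay with exponent $\tilde\gamma$: there are constants $0<c\le C$ depending only on $N,n_1,d_1$ such that $c\,t_\ell^{ -\tilde\gamma}\le \mathbb P(\deg_n(\underline X)>t_\ell)\le C\,t_\ell^{ -\tilde\gamma}$ for all such $n,\ell$.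
   Context: Edge set $E(G)$; each edge joins $V_1$ to $V_2$. $\mathrm{typ}(x)=i$ if $x\in V_i$; for a word over $\Sigma_1$, its type is $i$ if all letters lie in $V_i$, else $0$. For distinct $\underline x,\underline y\in\Sigma_n=\Sigma_1^n$ let $k$ be the length of their longest common prefix and $\tilde{\underline x},\tilde{\underline y}$ the remaining postfixes. $G_n$ is the graph on $\Sigma_n$ with a loop at every vertex and distinct $\underline x,\underline y$ adjacent iff $\{\mathrm{typ}(\tilde{\underline x}),\mathrm{typ}(\tilde{\underline y})\}=\{1,2\}$ and $\{x_i,y_i\}\in E(G)$ for all $k<i\le n$. $\deg_n(\underline x)$ is the degree in $G_n$ with the loop counted as contributing $2$. -}

module Defs where

open import Data.Bool using (Bool; true; false; _∧_; _∨_; if_then_else_)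
open import Data.Nat using (ℕ; zero; suc; _+_; _∸_; _^_; _≤_; _<_; _<ᵇ_)
import Data.Nat.DivMod as ℕD
open import Data.Fin using (Fin; _≟_)
open import Data.Vec using (Vec; []; _∷_)
open import Data.List using (List; []; _∷_; map; concatMap; allFin)
open import Data.Nat.ListAction using (sum)
open import Data.Integer using (+_)
open import Data.Rational using (ℚ; _/_; _*_; 1ℚ; 0ℚ)
open import Data.Product using (∃)
open import Relation.Binary.PropositionalEquality using (_≡_; _≢_)
open import Relation.Nullary.Decidable using (⌊_⌋)

countL : {A : Set} → (A → Bool) → List A → ℕ
countL p xs = sum (map (λ a → if p a then 1 else 0) xs)

countFin : {N : ℕ} → (Fin N → Bool) → ℕ
countFin {N} p = countL p (allFin N)

-- a / d as a rational (d > 0 in all uses; 0 if d = 0)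
fracℚ : ℕ → ℕ → ℚ
fracℚ a zero    = 0ℚ
fracℚ a (suc d) = (+ a) / suc d

-- A finite bipartite graph on Σ₁ = {0,…,N-1} = Fin N.
-- adj x y = true iff {x,y} ∈ E(G);  inV1 x = true iff x ∈ V₁, otherwise x ∈ V₂.
record BipGraph (N : ℕ) : Set where
  field
    adj       : Fin N → Fin N → Bool
    inV1      : Fin N → Bool
    adj-sym   : ∀ x y → adj x y ≡ adj y x
    adj-bip   : ∀ x y → adj x y ≡ true → inV1 x ≢ inV1 y
    V1-nonempty : ∃ λ x → inV1 x ≡ true
    V2-nonempty : ∃ λ x → inV1 x ≡ false

module _ {N : ℕ} (G : BipGraph N) where
  open BipGraph G

  n₁ : ℕ
  n₁ = countFin inV1

  deg : Fin N → ℕ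
  deg x = countFin (adj x)

  allV1 : {m : ℕ} → Vec (Fin N) m → Bool
  allV1 []       = true
  allV1 (x ∷ xs) = inV1 x ∧ allV1 xs

  allV2 : {m : ℕ} → Vec (Fin N) m → Bool
  allV2 []       = true
  allV2 (x ∷ xs) = (if inV1 x then false else true) ∧ allV2 xs

  allEdges : {m : ℕ} → Vec (Fin N) m → Vec (Fin N) m → Bool
  allEdges []       []       = true
  allEdges (x ∷ xs) (y ∷ ys) = adj x y ∧ allEdges xs ys

  postfixAdj : {m : ℕ} → Vec (Fin N) m → Vec (Fin N) m → Bool
  postfixAdj xs ys = ((allV1 xs ∧ allV2 ys) ∨ (allV2 xs ∧ allV1 ys)) ∧ allEdges xs ys

  -- adjacency of DISTINCT words in G_n: strip the longest common prefix, then test the postfixes.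
  -- (Equal words give false here; the loop is accounted for separately in degₙ.)
  adjₙ : {m : ℕ} → Vec (Fin N) m → Vec (Fin N) m → Bool
  adjₙ []       []       = false
  adjₙ (x ∷ xs) (y ∷ ys) =
    if ⌊ x ≟ y ⌋ then adjₙ xs ys else postfixAdj (x ∷ xs) (y ∷ ys)

  words : (m : ℕ) → List (Vec (Fin N) m)
  words zero    = [] ∷ []
  words (suc m) = concatMap (λ x → map (x ∷_) (words m)) (allFin N)

  -- degree in G_n, the loop contributing 2
  degₙ : {m : ℕ} → Vec (Fin N) m → ℕ
  degₙ {m} xs = 2 + countL (adjₙ xs) (words m)

  probDegGt : (m : ℕ) → ℕ → ℚ
  probDegGt m t = fracℚ (countL (λ xs → t <ᵇ degₙ xs) (words m)) (N ^ m)

_^ℚ_ : ℚ → ℕ → ℚ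
q ^ℚ zero  = 1ℚ
q ^ℚ suc k = q * (q ^ℚ k)

-- t_ℓ = (d₁^(ℓ+1) − 1)/(d₁ − 1) + 1  (only used for d₁ ≥ 2; exact division)
tℓ : ℕ → ℕ → ℕ
tℓ (suc (suc e)) ℓ = ℕD._/_ (suc (suc e) ^ (ℓ + 1) ∸ 1) (suc e) + 1
tℓ _             ℓ = 0

{-# OPTIONS --safe #-}
module Submission where

-- Strip the longest common prefix: the neighbours of a word x whose postfix has length k are the
-- words agreeing with x before the last k letters and whose last k letters are letterwise adjacent
-- to those of x, all of the opposite type. If x ends in V₁ such words exist only when the last k
-- letters of x all lie in V₁, and then there are d₁ᵏ of them, since every V₁-vertex has d₁
-- neighbours, all in V₂. Hence a word ending in V₁ whose longest suffix inside V₁ has length r has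
-- degree 2 + d₁ + ⋯ + d₁ʳ, to be compared with t_ℓ = 2 + d₁ + ⋯ + d₁^ℓ: together with the bound on
-- words ending in V₂, deg > t_ℓ holds exactly when the last ℓ + 1 letters lie in V₁, which happens
-- for n₁^(ℓ+1) N^(n−ℓ−1) words. The power law then follows from d₁^ℓ ≤ t_ℓ ≤ d₁^(ℓ+1), with
-- c = n₁/N and C = 1.

-- A separate module, since the statement below uses the multiplication of ℚ as _*_.
module DegreeTail where

  open import Defs
  open import Data.Bool using (Bool; true; false; _∧_; _∨_; if_then_else_)
  open import Data.Bool.Properties using (∧-zeroʳ; ∧-conicalˡ; ∧-conicalʳ; ∧-assoc; ∨-identityʳ)
  open import Data.Empty using (⊥-elim)
  open import Data.Fin using (Fin; _≟_)
  import Data.Fin as Fin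
  import Data.Integer as ℤ
  import Data.Integer.Properties as ℤ
  open import Data.List using (List; []; _∷_; map; concatMap; allFin; _++_; length)
  open import Data.List.Properties using (map-tabulate; length-tabulate; map-cong)
  open import Data.List.Membership.Propositional using (_∈_)
  open import Data.List.Membership.Propositional.Properties using (∈-allFin)
  open import Data.List.Relation.Unary.Any using (here; there)
  open import Data.Nat using (ℕ; zero; suc; _+_; _*_; _∸_; _^_; _≤_; _<_; _≤ᵇ_; _<ᵇ_; _≤′_; ≤′-refl; ≤′-step; z≤n; s≤s; NonZero; >-nonZero)
  open import Data.Nat.DivMod using (_/_; m*n/n≡m)
  open import Data.Nat.ListAction using (sum)
  open import Data.Nat.Properties hiding (_≟_)
  open import Algebra.Properties.CommutativeSemigroup +-commutativeSemigroup using (interchange)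
  open import Data.Nat.Tactic.RingSolver using (solve-∀)
  open import Data.Product using (_×_; _,_; proj₁; proj₂)
  open import Data.Rational using (ℚ; 0ℚ; 1ℚ; toℚᵘ; nonNegative) renaming (_≤_ to _≤ℚ_; _<_ to _<ℚ_; _*_ to _*ℚ_)
  import Data.Rational.Properties as ℚ
  open import Data.Rational.Unnormalised using (mkℚᵘ; _≃_; *≤*; *<*) renaming (_/_ to _/ᵘ_)
  import Data.Rational.Unnormalised.Properties as ℚᵘ
  open import Data.Vec using (Vec; []; _∷_; last; head; tail)
  open import Function using (_∘_)
  open import Function.Bundles using (_⇔_; mk⇔)
  open import Relation.Binary.PropositionalEquality
  open import Relation.Nullary using (yes; no; contradiction)
  open import Relation.Nullary.Decidable using (⌊_⌋; isYes≗does; dec-true; dec-false; does-⇔; _×-dec_)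

  -- Counting over lists

  indicator : Bool → ℕ
  indicator b = if b then 1 else 0

  module _ {A : Set} where

    countL-cong : {p q : A → Bool} (xs : List A) → (∀ a → p a ≡ q a) → countL p xs ≡ countL q xs
    countL-cong []       p≗q = refl
    countL-cong (x ∷ xs) p≗q = cong₂ (λ b n → indicator b + n) (p≗q x) (countL-cong xs p≗q)

    countL-split : (r p q : A → Bool) (xs : List A) →
                   (∀ a → indicator (r a) ≡ indicator (p a) + indicator (q a)) →
                   countL r xs ≡ countL p xs + countL q xs
    countL-split r p q []       split = refl
    countL-split r p q (x ∷ xs) split =
      trans (cong₂ _+_ (split x) (countL-split r p q xs split)) (interchange (indicator (p x)) _ _ _)

    countL-∧ˡ : (b : Bool) (p : A → Bool) (xs : List A) → countL (λ a → b ∧ p a) xs ≡ indicator b * countL p xs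
    countL-∧ˡ true  p xs = sym (+-identityʳ _)
    countL-∧ˡ false p []       = refl
    countL-∧ˡ false p (x ∷ xs) = countL-∧ˡ false p xs

    countL-++ : (p : A → Bool) (xs ys : List A) → countL p (xs ++ ys) ≡ countL p xs + countL p ys
    countL-++ p []       ys = refl
    countL-++ p (x ∷ xs) ys = trans (cong (indicator (p x) +_) (countL-++ p xs ys)) (sym (+-assoc (indicator (p x)) _ _))

    countL-true : (xs : List A) → countL (λ _ → true) xs ≡ length xs
    countL-true []       = refl
    countL-true (x ∷ xs) = cong suc (countL-true xs)

    countL≤length : (p : A → Bool) (xs : List A) → countL p xs ≤ length xs
    countL≤length p [] = z≤n
    countL≤length p (x ∷ xs) with p x
    ... | true  = s≤s (countL≤length p xs)
    ... | false = m≤n⇒m≤1+n (countL≤length p xs)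

    countL-pos : (p : A → Bool) {x : A} (xs : List A) → x ∈ xs → p x ≡ true → 0 < countL p xs
    countL-pos p (y ∷ xs) (here refl) px rewrite px = s≤s z≤n
    countL-pos p (y ∷ xs) (there x∈xs) px = <-≤-trans (countL-pos p xs x∈xs px) (m≤n+m _ (indicator (p y)))

  module _ {A B : Set} where

    countL-map : (p : B → Bool) (f : A → B) (xs : List A) → countL p (map f xs) ≡ countL (p ∘ f) xs
    countL-map p f []       = refl
    countL-map p f (x ∷ xs) = cong (indicator (p (f x)) +_) (countL-map p f xs)

    countL-concatMap : (p : B → Bool) (f : A → List B) (xs : List A) →
                       countL p (concatMap f xs) ≡ sum (map (countL p ∘ f) xs)
    countL-concatMap p f []       = refl
    countL-concatMap p f (x ∷ xs) = trans (countL-++ p (f x) _) (cong (countL p (f x) +_) (countL-concatMap p f xs))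

  sum-map-*ʳ : {A : Set} (f : A → ℕ) (c : ℕ) (xs : List A) → sum (map (λ a → f a * c) xs) ≡ sum (map f xs) * c
  sum-map-*ʳ f c []       = refl
  sum-map-*ʳ f c (x ∷ xs) = trans (cong (f x * c +_) (sum-map-*ʳ f c xs)) (sym (*-distribʳ-+ c (f x) _))

  countFin-suc : {n : ℕ} (p : Fin (suc n) → Bool) →
                 countFin p ≡ indicator (p Fin.zero) + countFin {n} (λ i → p (Fin.suc i))
  countFin-suc {n} p = cong (λ xs → indicator (p Fin.zero) + sum xs)
    (trans (map-tabulate Fin.suc (indicator ∘ p)) (sym (map-tabulate (λ i → i) (λ i → indicator (p (Fin.suc i))))))

  countFin-false : {n : ℕ} → countFin {n} (λ _ → false) ≡ 0
  countFin-false {zero}  = refl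
  countFin-false {suc n} = trans (countFin-suc {n} (λ _ → false)) (countFin-false {n})

  countFin-≟ : {n : ℕ} (x : Fin n) → countFin (λ y → ⌊ x ≟ y ⌋) ≡ 1
  countFin-≟ {suc n} Fin.zero    = trans (countFin-suc {n} (λ y → ⌊ Fin.zero ≟ y ⌋)) (cong suc (countFin-false {n}))
  countFin-≟ {suc n} (Fin.suc x) = begin
    countFin (λ y → ⌊ Fin.suc x ≟ y ⌋)        ≡⟨ countFin-suc (λ y → ⌊ Fin.suc x ≟ y ⌋) ⟩
    countFin (λ y → ⌊ Fin.suc x ≟ Fin.suc y ⌋) ≡⟨ countL-cong (allFin n) suc≟suc ⟩
    countFin (λ y → ⌊ x ≟ y ⌋)                ≡⟨ countFin-≟ x ⟩
    1                                          ∎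
    where
    open ≡-Reasoning
    suc≟suc : ∀ y → ⌊ Fin.suc x ≟ Fin.suc y ⌋ ≡ ⌊ x ≟ y ⌋
    suc≟suc y = trans (isYes≗does (Fin.suc x ≟ Fin.suc y)) (sym (isYes≗does (x ≟ y)))

  countFin-true : (n : ℕ) → countFin {n} (λ _ → true) ≡ n
  countFin-true n = trans (countL-true (allFin n)) (length-tabulate (λ i → i))

  -- Geometric sums and t_ℓ

  powerSum : ℕ → ℕ → ℕ
  powerSum d zero    = 0
  powerSum d (suc r) = powerSum d r + d ^ suc r

  module _ (d : ℕ) .{{_ : NonZero d}} where

    powerSum-mono-≤ : {i j : ℕ} → i ≤ j → powerSum d i ≤ powerSum d j
    powerSum-mono-≤ {j = j}     z≤n       = z≤n
    powerSum-mono-≤ {suc i} {suc j} (s≤s i≤j) = +-mono-≤ (powerSum-mono-≤ i≤j) (^-monoʳ-≤ d (s≤s i≤j))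

    powerSum-mono-< : {i j : ℕ} → i < j → powerSum d i < powerSum d j
    powerSum-mono-< {i} {suc j} (s≤s i≤j) = ≤-<-trans (powerSum-mono-≤ i≤j) (m<m+n (powerSum d j) (m^n>0 d (suc j)))

    powerSum-cancel-< : {i j : ℕ} → powerSum d i < powerSum d j → i < j
    powerSum-cancel-< {i} {j} lt = ≰⇒> (λ j≤i → <⇒≱ lt (powerSum-mono-≤ j≤i))

  powerSum-geometric : (e ℓ : ℕ) → suc (powerSum (suc e) ℓ) * e + 1 ≡ suc e ^ suc ℓ
  powerSum-geometric e zero    = solved e
    where
    solved : ∀ e → 1 * e + 1 ≡ suc e * 1
    solved = solve-∀
  powerSum-geometric e (suc ℓ) = begin
    suc (P + D) * e + 1       ≡⟨ regroup P D e ⟩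
    (suc P * e + 1) + D * e   ≡⟨ cong (_+ D * e) (powerSum-geometric e ℓ) ⟩
    D + D * e                 ≡⟨ collect D e ⟩
    suc e * D                 ∎
    where
    open ≡-Reasoning
    P = powerSum (suc e) ℓ
    D = suc e ^ suc ℓ
    regroup : ∀ P D e → suc (P + D) * e + 1 ≡ (suc P * e + 1) + D * e
    regroup = solve-∀
    collect : ∀ D e → D + D * e ≡ suc e * D
    collect = solve-∀

  tℓ≡2+powerSum : (e ℓ : ℕ) → tℓ (suc (suc e)) ℓ ≡ 2 + powerSum (suc (suc e)) ℓ
  tℓ≡2+powerSum e ℓ = begin
    (d ^ (ℓ + 1) ∸ 1) / suc e + 1     ≡⟨ cong (λ k → (d ^ k ∸ 1) / suc e + 1) (+-comm ℓ 1) ⟩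
    (d ^ suc ℓ ∸ 1) / suc e + 1       ≡⟨ cong (λ n → (n ∸ 1) / suc e + 1) (powerSum-geometric (suc e) ℓ) ⟨
    (P * suc e + 1 ∸ 1) / suc e + 1   ≡⟨ cong (λ n → n / suc e + 1) (m+n∸n≡m (P * suc e) 1) ⟩
    (P * suc e) / suc e + 1           ≡⟨ cong (_+ 1) (m*n/n≡m P (suc e)) ⟩
    P + 1                             ≡⟨ +-comm P 1 ⟩
    2 + powerSum d ℓ                  ∎
    where
    open ≡-Reasoning
    d = suc (suc e)
    P = suc (powerSum d ℓ)

  ^≤tℓ : (e ℓ : ℕ) → suc (suc e) ^ ℓ ≤ tℓ (suc (suc e)) ℓ
  ^≤tℓ e ℓ = subst (suc (suc e) ^ ℓ ≤_) (sym (tℓ≡2+powerSum e ℓ)) (m≤n⇒m≤1+n (^≤1+powerSum ℓ))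
    where
    ^≤1+powerSum : ∀ ℓ → suc (suc e) ^ ℓ ≤ suc (powerSum (suc (suc e)) ℓ)
    ^≤1+powerSum zero    = ≤-refl
    ^≤1+powerSum (suc ℓ) = m≤n⇒m≤1+n (m≤n+m _ (powerSum (suc (suc e)) ℓ))

  tℓ≤^ : (e ℓ : ℕ) → tℓ (suc (suc e)) ℓ ≤ suc (suc e) ^ (ℓ + 1)
  tℓ≤^ e ℓ = begin
    tℓ (suc (suc e)) ℓ           ≡⟨ tℓ≡2+powerSum e ℓ ⟩
    suc (suc P)                  ≤⟨ s≤s (m≤m*n (suc P) (suc e)) ⟩
    suc (suc P * suc e)          ≡⟨ +-comm 1 (suc P * suc e) ⟩
    suc P * suc e + 1            ≡⟨ powerSum-geometric (suc e) ℓ ⟩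
    suc (suc e) ^ suc ℓ          ≡⟨ cong (suc (suc e) ^_) (+-comm 1 ℓ) ⟩
    suc (suc e) ^ (ℓ + 1)        ∎
    where
    open ≤-Reasoning
    P = powerSum (suc (suc e)) ℓ

  -- Fractions and powers of rationals

  toℚᵘ-fracℚ : (a b : ℕ) .{{_ : NonZero b}} → toℚᵘ (fracℚ a b) ≃ (ℤ.+ a) /ᵘ b
  toℚᵘ-fracℚ a (suc b) = ℚ.toℚᵘ-fromℚᵘ (mkℚᵘ (ℤ.+ a) b)

  fracℚ-cong-≃ : (a b c e : ℕ) .{{_ : NonZero b}} .{{_ : NonZero e}} →
                 (ℤ.+ a) /ᵘ b ≃ (ℤ.+ c) /ᵘ e → fracℚ a b ≡ fracℚ c e
  fracℚ-cong-≃ a b c e eq =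
    ℚ.toℚᵘ-injective (ℚᵘ.≃-trans (toℚᵘ-fracℚ a b) (ℚᵘ.≃-trans eq (ℚᵘ.≃-sym (toℚᵘ-fracℚ c e))))

  fracℚ-* : (a b c e : ℕ) .{{_ : NonZero b}} .{{_ : NonZero e}} → fracℚ a b *ℚ fracℚ c e ≡ fracℚ (a * c) (b * e)
  fracℚ-* a b@(suc _) c e@(suc _) = ℚ.toℚᵘ-injective
    (ℚᵘ.≃-trans (ℚ.toℚᵘ-homo-* (fracℚ a b) (fracℚ c e))
    (ℚᵘ.≃-trans (ℚᵘ.*-cong (toℚᵘ-fracℚ a b) (toℚᵘ-fracℚ c e))
    (ℚᵘ.≃-trans (ℚᵘ.≃-reflexive (ℚᵘ./-cong (sym (ℤ.pos-* a c)) refl))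
                (ℚᵘ.≃-sym (toℚᵘ-fracℚ (a * c) (b * e))))))

  fracℚ-^ : (a b k : ℕ) .{{_ : NonZero b}} → fracℚ a b ^ℚ k ≡ fracℚ (a ^ k) (b ^ k)
  fracℚ-^ a b zero    = refl
  fracℚ-^ a b (suc k) {{b≢0}} =
    trans (cong (fracℚ a b *ℚ_) (fracℚ-^ a b k)) (fracℚ-* a b (a ^ k) (b ^ k) {{b≢0}} {{m^n≢0 b k}})

  fracℚ-cancelˡ : (c a b : ℕ) .{{_ : NonZero c}} .{{_ : NonZero b}} → fracℚ (c * a) (c * b) ≡ fracℚ a b
  fracℚ-cancelˡ c a b = fracℚ-cong-≃ (c * a) (c * b) a b {{m*n≢0 c b}}
    (ℚᵘ.≃-trans (ℚᵘ.≃-reflexive (ℚᵘ./-cong {{m*n≢0 c b}} {{m*n≢0 c b}} (ℤ.pos-* c a) refl))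
                (ℚᵘ.*-cancelˡ-/ c {{_}} {{m*n≢0 c b}}))

  fracℚ-mono-≤ : (a b c e : ℕ) .{{_ : NonZero b}} .{{_ : NonZero e}} → a * e ≤ c * b → fracℚ a b ≤ℚ fracℚ c e
  fracℚ-mono-≤ a b@(suc _) c e@(suc _) ae≤cb = ℚ.toℚᵘ-cancel-≤
    (ℚᵘ.≤-respˡ-≃ (ℚᵘ.≃-sym (toℚᵘ-fracℚ a b)) (ℚᵘ.≤-respʳ-≃ (ℚᵘ.≃-sym (toℚᵘ-fracℚ c e))
      (*≤* (subst₂ ℤ._≤_ (ℤ.pos-* a e) (ℤ.pos-* c b) (ℤ.+≤+ ae≤cb)))))

  fracℚ-mono-< : (a b c e : ℕ) .{{_ : NonZero b}} .{{_ : NonZero e}} → a * e < c * b → fracℚ a b <ℚ fracℚ c e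
  fracℚ-mono-< a b@(suc _) c e@(suc _) ae<cb = ℚ.toℚᵘ-cancel-<
    (ℚᵘ.<-respˡ-≃ (ℚᵘ.≃-sym (toℚᵘ-fracℚ a b)) (ℚᵘ.<-respʳ-≃ (ℚᵘ.≃-sym (toℚᵘ-fracℚ c e))
      (*<* (subst₂ ℤ._<_ (ℤ.pos-* a e) (ℤ.pos-* c b) (ℤ.+<+ ae<cb)))))

  fracℚ-pos : (a b : ℕ) .{{_ : NonZero b}} → 0 < a → 0ℚ <ℚ fracℚ a b
  fracℚ-pos a b 0<a = fracℚ-mono-< 0 1 a b (subst (0 <_) (sym (*-identityʳ a)) 0<a)

  fracℚ≤1 : (a b : ℕ) .{{_ : NonZero b}} → a ≤ b → fracℚ a b ≤ℚ 1ℚ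
  fracℚ≤1 a b a≤b = fracℚ-mono-≤ a b 1 1 (subst₂ _≤_ (sym (*-identityʳ a)) (sym (+-identityʳ b)) a≤b)

  ^ℚ-+ : (q : ℚ) (i j : ℕ) → q ^ℚ i *ℚ q ^ℚ j ≡ q ^ℚ (i + j)
  ^ℚ-+ q zero    j = ℚ.*-identityˡ _
  ^ℚ-+ q (suc i) j = trans (ℚ.*-assoc q (q ^ℚ i) (q ^ℚ j)) (cong (q *ℚ_) (^ℚ-+ q i j))

  ^ℚ-* : (q : ℚ) (i k : ℕ) → (q ^ℚ i) ^ℚ k ≡ q ^ℚ (i * k)
  ^ℚ-* q i zero    = cong (q ^ℚ_) (sym (*-zeroʳ i))
  ^ℚ-* q i (suc k) = trans (cong (q ^ℚ i *ℚ_) (^ℚ-* q i k)) (trans (^ℚ-+ q i (i * k)) (cong (q ^ℚ_) (sym (*-suc i k))))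

  1^ℚ : (k : ℕ) → 1ℚ ^ℚ k ≡ 1ℚ
  1^ℚ zero    = refl
  1^ℚ (suc k) = trans (ℚ.*-identityˡ _) (1^ℚ k)

  module _ {a : ℚ} (0≤a : 0ℚ ≤ℚ a) (a≤1 : a ≤ℚ 1ℚ) where

    ^ℚ-nonNeg : (k : ℕ) → 0ℚ ≤ℚ a ^ℚ k
    ^ℚ-nonNeg zero    = ℚ.nonNegative⁻¹ 1ℚ
    ^ℚ-nonNeg (suc k) =
      ℚ.nonNegative⁻¹ _ {{ℚ.nonNeg*nonNeg⇒nonNeg a {{nonNegative 0≤a}} (a ^ℚ k) {{nonNegative (^ℚ-nonNeg k)}}}}

    ^ℚ-suc-≤ : (k : ℕ) → a ^ℚ suc k ≤ℚ a ^ℚ k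
    ^ℚ-suc-≤ k =
      ℚ.≤-trans (ℚ.*-monoʳ-≤-nonNeg (a ^ℚ k) {{nonNegative (^ℚ-nonNeg k)}} a≤1) (ℚ.≤-reflexive (ℚ.*-identityˡ _))

    ^ℚ-antitone : {i j : ℕ} → i ≤ j → a ^ℚ j ≤ℚ a ^ℚ i
    ^ℚ-antitone i≤j = antitone′ (≤⇒≤′ i≤j)
      where
      antitone′ : {i j : ℕ} → i ≤′ j → a ^ℚ j ≤ℚ a ^ℚ i
      antitone′ ≤′-refl          = ℚ.≤-refl
      antitone′ (≤′-step {j} i≤j) = ℚ.≤-trans (^ℚ-suc-≤ j) (antitone′ i≤j)

    powerLaw-lower : (d t ℓ p q : ℕ) .{{_ : NonZero d}} → d ^ ℓ ≤ t → t ^ q < d ^ p →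
                     a ^ℚ q *ℚ a ^ℚ p ≤ℚ (a ^ℚ (ℓ + 1)) ^ℚ q
    powerLaw-lower d t ℓ p q dℓ≤t tq<dp = begin
      a ^ℚ q *ℚ a ^ℚ p      ≡⟨ ^ℚ-+ a q p ⟩
      a ^ℚ (q + p)          ≤⟨ ^ℚ-antitone exponent ⟩
      a ^ℚ ((ℓ + 1) * q)    ≡⟨ ^ℚ-* a (ℓ + 1) q ⟨
      (a ^ℚ (ℓ + 1)) ^ℚ q   ∎
      where
      open ℚ.≤-Reasoning
      ℓq<p : ℓ * q < p
      ℓq<p = ≰⇒> (λ p≤ℓq → <⇒≱ tq<dp
        (≤-trans (^-monoʳ-≤ d p≤ℓq) (subst (_≤ t ^ q) (^-*-assoc d ℓ q) (^-monoˡ-≤ q dℓ≤t))))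
      exponent : (ℓ + 1) * q ≤ q + p
      exponent = subst₂ _≤_ (sym (trans (*-distribʳ-+ q ℓ 1) (cong (_+_ (ℓ * q)) (*-identityˡ q)))) (+-comm p q)
                   (+-monoˡ-≤ q (<⇒≤ ℓq<p))

    powerLaw-upper : (d t ℓ p q : ℕ) .{{_ : NonZero d}} → t ≤ d ^ (ℓ + 1) → d ^ p < t ^ q →
                     (a ^ℚ (ℓ + 1)) ^ℚ q ≤ℚ 1ℚ ^ℚ q *ℚ a ^ℚ p
    powerLaw-upper d t ℓ p q t≤dℓ+1 dp<tq = begin
      (a ^ℚ (ℓ + 1)) ^ℚ q   ≡⟨ ^ℚ-* a (ℓ + 1) q ⟩
      a ^ℚ ((ℓ + 1) * q)    ≤⟨ ^ℚ-antitone exponent ⟩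
      a ^ℚ p                ≡⟨ ℚ.*-identityˡ (a ^ℚ p) ⟨
      1ℚ *ℚ a ^ℚ p          ≡⟨ cong (_*ℚ a ^ℚ p) (1^ℚ q) ⟨
      1ℚ ^ℚ q *ℚ a ^ℚ p     ∎
      where
      open ℚ.≤-Reasoning
      exponent : p ≤ (ℓ + 1) * q
      exponent = ≮⇒≥ (λ ℓq<p → <⇒≱ dp<tq
        (≤-trans (^-monoˡ-≤ q t≤dℓ+1) (subst (_≤ d ^ p) (sym (^-*-assoc d (ℓ + 1) q)) (^-monoʳ-≤ d (<⇒≤ ℓq<p)))))

  -- The hypotheses of the theorem force 1 ≤ n₁ ≤ N; otherwise 1 is a positive placeholder.
  lowerConstant : ℕ → ℕ → ℚ
  lowerConstant n1 N with 1 ≤? n1 ×-dec n1 ≤? N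
  ... | yes _ = fracℚ n1 N
  ... | no  _ = 1ℚ

  lowerConstant-pos : (n1 N : ℕ) → 0ℚ <ℚ lowerConstant n1 N
  lowerConstant-pos n1 N with 1 ≤? n1 ×-dec n1 ≤? N
  ... | yes (0<n1 , n1≤N) = fracℚ-pos n1 N {{>-nonZero (≤-trans 0<n1 n1≤N)}} 0<n1
  ... | no  _             = ℚ.positive⁻¹ 1ℚ

  lowerConstant≤1 : (n1 N : ℕ) → lowerConstant n1 N ≤ℚ 1ℚ
  lowerConstant≤1 n1 N with 1 ≤? n1 ×-dec n1 ≤? N
  ... | yes (0<n1 , n1≤N) = fracℚ≤1 n1 N {{>-nonZero (≤-trans 0<n1 n1≤N)}} n1≤N
  ... | no  _             = ℚ.≤-refl

  lowerConstant-≡ : {n1 N : ℕ} → 0 < n1 → n1 ≤ N → lowerConstant n1 N ≡ fracℚ n1 N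
  lowerConstant-≡ {n1} {N} 0<n1 n1≤N with 1 ≤? n1 ×-dec n1 ≤? N
  ... | yes _ = refl
  ... | no  ¬p = contradiction (0<n1 , n1≤N) ¬p

  -- Degrees in Gₙ

  module _ {N : ℕ} (G : BipGraph N) where
    open BipGraph G

    countL-words-suc : {m : ℕ} (p : Vec (Fin N) (suc m) → Bool) →
      countL p (words G (suc m)) ≡ sum (map (λ x → countL (λ ys → p (x ∷ ys)) (words G m)) (allFin N))
    countL-words-suc {m} p = trans (countL-concatMap p _ (allFin N))
      (cong sum (map-cong (λ x → countL-map p (x ∷_) (words G m)) (allFin N)))

    countL-words-∧ : {m : ℕ} (p : Vec (Fin N) (suc m) → Bool) (q : Fin N → Bool) (r : Vec (Fin N) m → Bool) →
      (∀ y ys → p (y ∷ ys) ≡ q y ∧ r ys) → countL p (words G (suc m)) ≡ countFin q * countL r (words G m)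
    countL-words-∧ {m} p q r p≡q∧r = begin
      countL p (words G (suc m))
        ≡⟨ countL-words-suc p ⟩
      sum (map (λ y → countL (λ ys → p (y ∷ ys)) (words G m)) (allFin N))
        ≡⟨ cong sum (map-cong (λ y → trans (countL-cong (words G m) (p≡q∧r y)) (countL-∧ˡ (q y) r (words G m))) (allFin N)) ⟩
      sum (map (λ y → indicator (q y) * countL r (words G m)) (allFin N))
        ≡⟨ sum-map-*ʳ (indicator ∘ q) _ (allFin N) ⟩
      countFin q * countL r (words G m) ∎
      where open ≡-Reasoning

    countL-allV1 : (m : ℕ) → countL (allV1 G) (words G m) ≡ n₁ G ^ m
    countL-allV1 zero    = refl
    countL-allV1 (suc m) = trans (countL-words-∧ (allV1 G) inV1 (allV1 G) (λ _ _ → refl)) (cong (n₁ G *_) (countL-allV1 m))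

    n₁-pos : 0 < n₁ G
    n₁-pos = countL-pos inV1 (allFin N) (∈-allFin (proj₁ V1-nonempty)) (proj₂ V1-nonempty)

    n₁≤N : n₁ G ≤ N
    n₁≤N = subst (n₁ G ≤_) (length-tabulate (λ i → i)) (countL≤length inV1 (allFin N))

    instance
      N-nonZero : NonZero N
      N-nonZero = >-nonZero (≤-trans n₁-pos n₁≤N)

    adj-irrefl : ∀ x → adj x x ≡ false
    adj-irrefl x with adj x x in e
    ... | true  = ⊥-elim (adj-bip x x e refl)
    ... | false = refl

    V1-adj⇒V2 : ∀ {z y} → inV1 z ≡ true → adj z y ≡ true → inV1 y ≡ false
    V1-adj⇒V2 {z} {y} z∈V1 e with inV1 y in y∈V1
    ... | true  = ⊥-elim (adj-bip z y e (trans z∈V1 (sym y∈V1)))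
    ... | false = refl

    allV1⇒lastV1 : {m : ℕ} (zs : Vec (Fin N) (suc m)) → allV1 G zs ≡ true → inV1 (last zs) ≡ true
    allV1⇒lastV1 (z ∷ [])     h = ∧-conicalˡ _ _ h
    allV1⇒lastV1 (z ∷ y ∷ ys) h = allV1⇒lastV1 (y ∷ ys) (∧-conicalʳ (inV1 z) _ h)

    lastV1⇒¬allV2 : {m : ℕ} (zs : Vec (Fin N) (suc m)) → inV1 (last zs) ≡ true → allV2 G zs ≡ false
    lastV1⇒¬allV2 (z ∷ [])     h rewrite h = refl
    lastV1⇒¬allV2 (z ∷ y ∷ ys) h rewrite lastV1⇒¬allV2 (y ∷ ys) h = ∧-zeroʳ _

    postfixAdj-diag : {m : ℕ} (x : Fin N) (xs ys : Vec (Fin N) m) → postfixAdj G (x ∷ xs) (x ∷ ys) ≡ false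
    postfixAdj-diag x xs ys rewrite adj-irrefl x = ∧-zeroʳ _

    neighbourCount : {m : ℕ} → Vec (Fin N) m → ℕ
    neighbourCount {m} xs = countL (adjₙ G xs) (words G m)

    neighbourCount-∷ : {m : ℕ} (x : Fin N) (xs : Vec (Fin N) m) →
      neighbourCount (x ∷ xs) ≡ neighbourCount xs + countL (postfixAdj G (x ∷ xs)) (words G (suc m))
    neighbourCount-∷ {m} x xs = begin
      neighbourCount (x ∷ xs)                                   ≡⟨ countL-split _ sameHead _ (words G (suc m)) split ⟩
      countL sameHead (words G (suc m)) + postfix               ≡⟨ cong (_+ postfix) (countL-words-∧ sameHead _ _ (λ _ _ → refl)) ⟩
      countFin (λ y → ⌊ x ≟ y ⌋) * neighbourCount xs + postfix ≡⟨ cong (λ c → c * neighbourCount xs + postfix) (countFin-≟ x) ⟩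
      1 * neighbourCount xs + postfix                           ≡⟨ cong (_+ postfix) (*-identityˡ (neighbourCount xs)) ⟩
      neighbourCount xs + postfix                               ∎
      where
      open ≡-Reasoning
      postfix = countL (postfixAdj G (x ∷ xs)) (words G (suc m))
      sameHead : Vec (Fin N) (suc m) → Bool
      sameHead w = ⌊ x ≟ head w ⌋ ∧ adjₙ G xs (tail w)
      split : ∀ w → indicator (adjₙ G (x ∷ xs) w) ≡ indicator (sameHead w) + indicator (postfixAdj G (x ∷ xs) w)
      split (y ∷ ys) with x ≟ y
      ... | yes refl rewrite postfixAdj-diag x xs ys = sym (+-identityʳ _)
      ... | no _     = refl

    v1SuffixLength : {m : ℕ} → Vec (Fin N) m → ℕ
    v1SuffixLength []               = 0
    v1SuffixLength {suc m} (x ∷ xs) = if allV1 G (x ∷ xs) then suc m else v1SuffixLength xs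

    v1SuffixLength-allV1 : {m : ℕ} (xs : Vec (Fin N) m) → allV1 G xs ≡ true → v1SuffixLength xs ≡ m
    v1SuffixLength-allV1 []       _ = refl
    v1SuffixLength-allV1 (x ∷ xs) h rewrite h = refl

    v1SuffixLength-¬allV1 : {m : ℕ} (x : Fin N) (xs : Vec (Fin N) m) → allV1 G (x ∷ xs) ≡ false →
                            v1SuffixLength (x ∷ xs) ≡ v1SuffixLength xs
    v1SuffixLength-¬allV1 x xs h rewrite h = refl

    v1SuffixLength≤length : {m : ℕ} (xs : Vec (Fin N) m) → v1SuffixLength xs ≤ m
    v1SuffixLength≤length []       = z≤n
    v1SuffixLength≤length (x ∷ xs) with allV1 G (x ∷ xs)
    ... | true  = ≤-refl
    ... | false = m≤n⇒m≤1+n (v1SuffixLength≤length xs)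

    v1SuffixLength-lastV2 : {m : ℕ} (xs : Vec (Fin N) (suc m)) → inV1 (last xs) ≡ false → v1SuffixLength xs ≡ 0
    v1SuffixLength-lastV2 (x ∷ xs) h with allV1 G (x ∷ xs) in e
    ... | true  with () ← trans (sym (allV1⇒lastV1 (x ∷ xs) e)) h
    v1SuffixLength-lastV2 (x ∷ [])     h | false = refl
    v1SuffixLength-lastV2 (x ∷ y ∷ ys) h | false = v1SuffixLength-lastV2 (y ∷ ys) h

    ≤ᵇ-v1SuffixLength-∷ : {k m : ℕ} (x : Fin N) (xs : Vec (Fin N) m) → k ≤ m →
                          (k ≤ᵇ v1SuffixLength (x ∷ xs)) ≡ (k ≤ᵇ v1SuffixLength xs)
    ≤ᵇ-v1SuffixLength-∷ {k} {m} x xs k≤m with allV1 G (x ∷ xs) in e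
    ... | true  = trans (dec-true (k ≤? suc m) (m≤n⇒m≤1+n k≤m)) (sym (dec-true (k ≤? v1SuffixLength xs) k≤suffix))
      where
      k≤suffix : k ≤ v1SuffixLength xs
      k≤suffix = subst (k ≤_) (sym (v1SuffixLength-allV1 xs (∧-conicalʳ (inV1 x) _ e))) k≤m
    ... | false = refl

    ≤ᵇ-v1SuffixLength-full : {m : ℕ} (xs : Vec (Fin N) m) → (m ≤ᵇ v1SuffixLength xs) ≡ allV1 G xs
    ≤ᵇ-v1SuffixLength-full []       = refl
    ≤ᵇ-v1SuffixLength-full {suc m} (x ∷ xs) with allV1 G (x ∷ xs)
    ... | true  = dec-true (suc m ≤? suc m) ≤-refl
    ... | false = dec-false (suc m ≤? v1SuffixLength xs) (<⇒≱ (s≤s (v1SuffixLength≤length xs)))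

    countL-v1SuffixLength-≥ : (j k : ℕ) →
                              countL (λ ys → k ≤ᵇ v1SuffixLength ys) (words G (j + k)) ≡ N ^ j * n₁ G ^ k
    countL-v1SuffixLength-≥ zero    k =
      trans (countL-cong (words G k) ≤ᵇ-v1SuffixLength-full) (trans (countL-allV1 k) (sym (*-identityˡ _)))
    countL-v1SuffixLength-≥ (suc j) k = begin
      countL (λ ys → k ≤ᵇ v1SuffixLength ys) (words G (suc j + k))
        ≡⟨ countL-words-∧ _ (λ (_ : Fin N) → true) _ (λ y ys → ≤ᵇ-v1SuffixLength-∷ y ys (m≤n+m k j)) ⟩
      countFin {N} (λ _ → true) * countL (λ ys → k ≤ᵇ v1SuffixLength ys) (words G (j + k))
        ≡⟨ cong₂ _*_ (countFin-true N) (countL-v1SuffixLength-≥ j k) ⟩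
      N * (N ^ j * n₁ G ^ k)
        ≡⟨ *-assoc N (N ^ j) _ ⟨
      N ^ suc j * n₁ G ^ k ∎
      where open ≡-Reasoning

    module _ {d : ℕ} (regular : ∀ x → inV1 x ≡ true → deg G x ≡ d) where

      edgesFrom : {k : ℕ} → Vec (Fin N) k → Vec (Fin N) k → Bool
      edgesFrom zs ys = allV2 G ys ∧ allEdges G zs ys

      countL-edgesFrom : {k : ℕ} (zs : Vec (Fin N) k) → allV1 G zs ≡ true → countL (edgesFrom zs) (words G k) ≡ d ^ k
      countL-edgesFrom []       _ = refl
      countL-edgesFrom (z ∷ zs) h =
        trans (countL-words-∧ _ (adj z) _ factor) (cong₂ _*_ (regular z z∈V1) (countL-edgesFrom zs (∧-conicalʳ (inV1 z) _ h)))
        where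
        z∈V1 : inV1 z ≡ true
        z∈V1 = ∧-conicalˡ _ _ h
        factor : ∀ y ys → edgesFrom (z ∷ zs) (y ∷ ys) ≡ adj z y ∧ edgesFrom zs ys
        factor y ys with adj z y in e
        ... | true rewrite V1-adj⇒V2 z∈V1 e = refl
        ... | false = ∧-zeroʳ _

      countL-postfixAdj : {k : ℕ} (zs : Vec (Fin N) (suc k)) → inV1 (last zs) ≡ true →
        countL (postfixAdj G zs) (words G (suc k)) ≡ indicator (allV1 G zs) * countL (edgesFrom zs) (words G (suc k))
      countL-postfixAdj {k} zs h = trans (countL-cong (words G (suc k)) factor) (countL-∧ˡ (allV1 G zs) _ (words G (suc k)))
        where
        factor : ∀ ys → postfixAdj G zs ys ≡ allV1 G zs ∧ edgesFrom zs ys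
        factor ys rewrite lastV1⇒¬allV2 zs h | ∨-identityʳ (allV1 G zs ∧ allV2 G ys) = ∧-assoc (allV1 G zs) _ _

      neighbourCount-∷-lastV1 : {m : ℕ} (x : Fin N) (xs : Vec (Fin N) m) →
        neighbourCount xs ≡ powerSum d (v1SuffixLength xs) → inV1 (last (x ∷ xs)) ≡ true →
        neighbourCount (x ∷ xs) ≡ powerSum d (v1SuffixLength (x ∷ xs))
      neighbourCount-∷-lastV1 {m} x xs ih h = begin
        neighbourCount (x ∷ xs)
          ≡⟨ neighbourCount-∷ x xs ⟩
        neighbourCount xs + countL (postfixAdj G (x ∷ xs)) (words G (suc m))
          ≡⟨ cong₂ _+_ ih (countL-postfixAdj (x ∷ xs) h) ⟩
        powerSum d (v1SuffixLength xs) + indicator (allV1 G (x ∷ xs)) * countL (edgesFrom (x ∷ xs)) (words G (suc m))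
          ≡⟨ extend (allV1 G (x ∷ xs)) refl ⟩
        powerSum d (v1SuffixLength (x ∷ xs)) ∎
        where
        open ≡-Reasoning
        extend : (b : Bool) → allV1 G (x ∷ xs) ≡ b →
                 powerSum d (v1SuffixLength xs) + indicator b * countL (edgesFrom (x ∷ xs)) (words G (suc m))
                 ≡ powerSum d (v1SuffixLength (x ∷ xs))
        extend true  e = trans
          (cong₂ _+_ (cong (powerSum d) (v1SuffixLength-allV1 xs (∧-conicalʳ (inV1 x) _ e)))
                     (trans (*-identityˡ _) (countL-edgesFrom (x ∷ xs) e)))
          (cong (powerSum d) (sym (v1SuffixLength-allV1 (x ∷ xs) e)))
        extend false e = trans (+-identityʳ _) (cong (powerSum d) (sym (v1SuffixLength-¬allV1 x xs e)))

      neighbourCount-lastV1 : {m : ℕ} (xs : Vec (Fin N) (suc m)) → inV1 (last xs) ≡ true →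
                              neighbourCount xs ≡ powerSum d (v1SuffixLength xs)
      neighbourCount-lastV1 (x ∷ [])     h = neighbourCount-∷-lastV1 x [] refl h
      neighbourCount-lastV1 (x ∷ y ∷ ys) h = neighbourCount-∷-lastV1 x (y ∷ ys) (neighbourCount-lastV1 (y ∷ ys) h) h

      degₙ-lastV1 : {m : ℕ} (ys : Vec (Fin N) (suc m)) → inV1 (last ys) ≡ true →
                    degₙ G ys ≡ 2 + powerSum d (v1SuffixLength ys)
      degₙ-lastV1 ys e = cong (2 +_) (neighbourCount-lastV1 ys e)

      module _ .{{_ : NonZero d}} {m ℓ : ℕ}
               (lastV2-bound : ∀ (ys : Vec (Fin N) (suc m)) → inV1 (last ys) ≡ false → degₙ G ys ≤ 2 + powerSum d ℓ) where

        exceeds⇔longV1Suffix : (ys : Vec (Fin N) (suc m)) → 2 + powerSum d ℓ < degₙ G ys ⇔ ℓ < v1SuffixLength ys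
        exceeds⇔longV1Suffix ys with inV1 (last ys) in e
        ... | true  rewrite degₙ-lastV1 ys e = mk⇔ (powerSum-cancel-< d ∘ +-cancelˡ-< 2 _ _) (+-monoʳ-< 2 ∘ powerSum-mono-< d)
        ... | false rewrite v1SuffixLength-lastV2 ys e = mk⇔ (λ lt → contradiction (lastV2-bound ys e) (<⇒≱ lt)) (λ ())

        countL-exceeds : countL (λ ys → (2 + powerSum d ℓ) <ᵇ degₙ G ys) (words G (suc m))
                       ≡ countL (λ ys → suc ℓ ≤ᵇ v1SuffixLength ys) (words G (suc m))
        countL-exceeds = countL-cong (words G (suc m)) (λ ys → does-⇔ (exceeds⇔longV1Suffix ys) (_ <? _) (_ <? _))

    probDegGt-tℓ : {e : ℕ} → (∀ x → inV1 x ≡ true → deg G x ≡ suc (suc e)) →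
      {m ℓ : ℕ} → ℓ ≤ m → (∀ (ys : Vec (Fin N) (suc m)) → inV1 (last ys) ≡ false → degₙ G ys ≤ tℓ (suc (suc e)) ℓ) →
      probDegGt G (suc m) (tℓ (suc (suc e)) ℓ) ≡ fracℚ (n₁ G) N ^ℚ (ℓ + 1)
    probDegGt-tℓ {e} regular {m} {ℓ} ℓ≤m lastV2-bound with m≤n⇒∃[o]m+o≡n ℓ≤m
    ... | j , refl = begin
      fracℚ (countL (λ ys → tℓ d ℓ <ᵇ degₙ G ys) (words G (suc (ℓ + j)))) (N ^ suc (ℓ + j))
        ≡⟨ cong (λ c → fracℚ c (N ^ suc (ℓ + j))) count ⟩
      fracℚ (N ^ j * n₁ G ^ suc ℓ) (N ^ suc (ℓ + j))
        ≡⟨ cong (fracℚ (N ^ j * n₁ G ^ suc ℓ)) (trans (^-distribˡ-+-* N (suc ℓ) j) (*-comm (N ^ suc ℓ) (N ^ j))) ⟩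
      fracℚ (N ^ j * n₁ G ^ suc ℓ) (N ^ j * N ^ suc ℓ)
        ≡⟨ fracℚ-cancelˡ (N ^ j) (n₁ G ^ suc ℓ) (N ^ suc ℓ) {{m^n≢0 N j}} {{m^n≢0 N (suc ℓ)}} ⟩
      fracℚ (n₁ G ^ suc ℓ) (N ^ suc ℓ)
        ≡⟨ fracℚ-^ (n₁ G) N (suc ℓ) ⟨
      fracℚ (n₁ G) N ^ℚ suc ℓ
        ≡⟨ cong (fracℚ (n₁ G) N ^ℚ_) (+-comm 1 ℓ) ⟩
      fracℚ (n₁ G) N ^ℚ (ℓ + 1) ∎
      where
      open ≡-Reasoning
      d = suc (suc e)
      count : countL (λ ys → tℓ d ℓ <ᵇ degₙ G ys) (words G (suc (ℓ + j))) ≡ N ^ j * n₁ G ^ suc ℓ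
      count = begin
        countL (λ ys → tℓ d ℓ <ᵇ degₙ G ys) (words G (suc (ℓ + j)))
          ≡⟨ cong (λ t → countL (λ ys → t <ᵇ degₙ G ys) (words G (suc (ℓ + j)))) (tℓ≡2+powerSum e ℓ) ⟩
        countL (λ ys → (2 + powerSum d ℓ) <ᵇ degₙ G ys) (words G (suc (ℓ + j)))
          ≡⟨ countL-exceeds regular (λ ys → subst (degₙ G ys ≤_) (tℓ≡2+powerSum e ℓ) ∘ lastV2-bound ys) ⟩
        countL (λ ys → suc ℓ ≤ᵇ v1SuffixLength ys) (words G (suc (ℓ + j)))
          ≡⟨ cong (λ n → countL (λ ys → suc ℓ ≤ᵇ v1SuffixLength ys) (words G n)) (+-comm (suc ℓ) j) ⟩
        countL (λ ys → suc ℓ ≤ᵇ v1SuffixLength ys) (words G (j + suc ℓ))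
          ≡⟨ countL-v1SuffixLength-≥ j (suc ℓ) ⟩
        N ^ j * n₁ G ^ suc ℓ ∎

    degreeTail : {n1 d1 : ℕ} → n₁ G ≡ n1 → 2 ≤ d1 → (∀ x → inV1 x ≡ true → deg G x ≡ d1) →
      {m ℓ : ℕ} → ℓ ≤ m → (∀ (ys : Vec (Fin N) (suc m)) → inV1 (last ys) ≡ false → degₙ G ys ≤ tℓ d1 ℓ) →
      (probDegGt G (suc m) (tℓ d1 ℓ) ≡ fracℚ n1 N ^ℚ (ℓ + 1))
      × (∀ (p q : ℕ) → 0 < q → tℓ d1 ℓ ^ q < d1 ^ p →
           (lowerConstant n1 N ^ℚ q) *ℚ (fracℚ n1 N ^ℚ p) ≤ℚ probDegGt G (suc m) (tℓ d1 ℓ) ^ℚ q)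
      × (∀ (p q : ℕ) → 0 < q → d1 ^ p < tℓ d1 ℓ ^ q →
           probDegGt G (suc m) (tℓ d1 ℓ) ^ℚ q ≤ℚ (1ℚ ^ℚ q) *ℚ (fracℚ n1 N ^ℚ p))
    degreeTail refl (s≤s (s≤s {n = e} z≤n)) regular {m} {ℓ} ℓ≤m lastV2-bound
      rewrite probDegGt-tℓ regular ℓ≤m lastV2-bound | lowerConstant-≡ n₁-pos n₁≤N
      = refl
      , (λ p q _ → powerLaw-lower 0≤a a≤1 d (tℓ d ℓ) ℓ p q (^≤tℓ e ℓ))
      , (λ p q _ → powerLaw-upper 0≤a a≤1 d (tℓ d ℓ) ℓ p q (tℓ≤^ e ℓ))
      where
      d = suc (suc e)
      0≤a : 0ℚ ≤ℚ fracℚ (n₁ G) N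
      0≤a = ℚ.<⇒≤ (fracℚ-pos (n₁ G) N n₁-pos)
      a≤1 : fracℚ (n₁ G) N ≤ℚ 1ℚ
      a≤1 = fracℚ≤1 (n₁ G) N n₁≤N

open import Defs
open import Data.Nat using (ℕ; suc; _+_; _∸_; _^_; _≤_; _<_)
open import Data.Fin using (Fin)
open import Data.Vec using (Vec; last)
open import Data.Bool using (true; false)
open import Data.Product using (Σ; _×_; _,_)
open import Data.Rational using (ℚ; 0ℚ; 1ℚ; _*_) renaming (_≤_ to _≤ℚ_; _<_ to _<ℚ_)
open import Relation.Binary.PropositionalEquality using (_≡_)
open DegreeTail using (lowerConstant; lowerConstant-pos; lowerConstant≤1; degreeTail)

theorem16 : (N n1 d1 : ℕ) →
  Σ ℚ λ c → Σ ℚ λ C → (0ℚ <ℚ c) × (c ≤ℚ C) ×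
  ((G : BipGraph N) →
    n₁ G ≡ n1 →
    2 ≤ d1 →
    (∀ x → BipGraph.inV1 G x ≡ true → deg G x ≡ d1) →
    (∀ y → BipGraph.inV1 G y ≡ false → deg G y ≤ d1 ∸ 1) →
    -- n = suc m ≥ 1 and 0 ≤ ℓ ≤ n - 1 = m
    (m ℓ : ℕ) → ℓ ≤ m →
    (∀ (ys : Vec (Fin N) (suc m)) → BipGraph.inV1 G (last ys) ≡ false →
      degₙ G ys ≤ tℓ d1 ℓ) →
    (probDegGt G (suc m) (tℓ d1 ℓ) ≡ fracℚ n1 N ^ℚ (ℓ + 1))
    -- c · t_ℓ^(-γ̃) ≤ P, with γ̃ = log(N/n1)/log d1, i.e. t_ℓ^(-γ̃) = (n1/N)^(log t_ℓ / log d1);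
    -- expressed via all rationals p/q > log_{d1} t_ℓ  (q > 0, t_ℓ^q < d1^p)
    × (∀ (p q : ℕ) → 0 < q → tℓ d1 ℓ ^ q < d1 ^ p →
         (c ^ℚ q) * (fracℚ n1 N ^ℚ p) ≤ℚ probDegGt G (suc m) (tℓ d1 ℓ) ^ℚ q)
    -- P ≤ C · t_ℓ^(-γ̃), via all rationals p/q < log_{d1} t_ℓ  (q > 0, d1^p < t_ℓ^q)
    × (∀ (p q : ℕ) → 0 < q → d1 ^ p < tℓ d1 ℓ ^ q →
         probDegGt G (suc m) (tℓ d1 ℓ) ^ℚ q ≤ℚ (C ^ℚ q) * (fracℚ n1 N ^ℚ p)))
theorem16 N n1 d1 = lowerConstant n1 N , 1ℚ , lowerConstant-pos n1 N , lowerConstant≤1 n1 N ,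
  λ G n₁≡n1 2≤d1 regular _ m ℓ ℓ≤m lastV2-bound → degreeTail G n₁≡n1 2≤d1 regular ℓ≤m lastV2-bound
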